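{- Let $\mathbb{A}$ be a basic Bi(B)BI algebra. (1) The prime filter frame $Pr(\mathbb{A})=(Pr(\mathbb{A}),\subseteq,\circ_{\mathbb{A}},E_{\mathbb{A}},\triangledown_{\mathbb{A}},U_{\mathbb{A}})$ is a basic Bi(B)BI frame. (2) If $\mathbb{A}$ satisfies any of the algebraic axioms Associativity, $\bot^*$ Weakening, $\bot^*$ Contraction, $\vee^*$ Contraction, or Weak Distributivity listed below, then $Pr(\mathbb{A})$ satisfies the corresponding frame property.
   Context: A (B)BI algebra is $(A,\wedge,\vee,\to,\top,\bot,*,\mathbin{ -\!\!*},\top^*)$ with Heyting (Boolean for BBI) reduct, $(A,*,\top^*)$ a commutative monoid and $a*b\le c$ iff $a\le b\mathbin{ -\!\!*}c$. A basic Bi(B)BI algebra additionally has a commutative binary operation $\vee^*$, a binary operation $\ominus$ and a constant $\bot^*$ with $a\le b\vee^*c$ iff $a\ominus b\le c$. A (B)BI frame $(X,\preccurlyeq,\circ,E)$: preorder $\preccurlyeq$ (equality for BBI), $\circ:X^2\to\mathcal{P}(X)$, $E\subseteq X$, with Commutativity, Closure ($e\in E\wedge e'\succcurlyeq e\to e'\in E$), Unit Existence $\exists e\in E(x\in x\circ e)$, Coherence $e\in E\wedge x\in y\circ e\to x\succcurlyeq y$, Associativity $t'\succcurlyeq t\in x\circ y\wedge w\in t'\circ z\to\exists s,s',w'(s'\succcurlyeq s\in y\circ z\wedge w\succcurlyeq w'\in x\circ s')$. A basic Bi(B)BI frame is $(X,\succcurlyeq,\circ,E,\triangledown,U)$ with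 $(X,\succcurlyeq,\circ,E)$ a (B)BI frame, $\triangledown:X^2\to\mathcal{P}(X)$ with $z\in x\triangledown y\to z\in y\triangledown x$, and $U\subseteq X$ with $u\in U\wedge u\succcurlyeq u'\to u'\in U$. Prime filter frame: $Pr(\mathbb{A})$ the prime filters; $F\circ_{\mathbb{A}}F'=\{F''\mid\forall a\in F,b\in F':a*b\in F''\}$; $E_{\mathbb{A}}=\{F\mid\top^*\in F\}$; $F\triangledown_{\mathbb{A}}F'=\{F''\mid\forall a,b:a\vee^*b\in F''\Rightarrow a\in F\text{ or }b\in F'\}$; $U_{\mathbb{A}}=\{F\mid\bot^*\notin F\}$. Axioms and frame correspondents (for BiBBI read $\preccurlyeq$ as $=$): Associativity: $a\vee^*(b\vee^*c)\le(a\vee^*b)\vee^*c$ / $t'\preccurlyeq t\in x\triangledown y\wedge w\in t'\triangledown z\to\exists s,s',w'(s'\preccurlyeq s\in y\triangledown z\wedge w\preccurlyeq w'\in x\triangledown s')$. $\bot^*$ Weakening: $a\le a\vee^*\bot^*$ / $u\in U\wedge x\in y\triangledown u\to x\preccurlyeq y$. $\bot^*$ Contraction: $a\vee^*\bot^*\le a$ / $\exists u\in U(w\in w\triangledown u)$. $\vee^*$ Contraction: $a\vee^*a\le a$ / $x\in x\triangledown x$. Weak Distributivity: $a*(b\vee^*c)\le(a*b)\vee^*c$ / $t'\succcurlyeq t\in x_1\circ x_2\wedge t'\preccurlyeq t''\in y_1\triangledown y_2\to\exists w(y_1\in x_1\circ w\wedge x_2\in w\triangledown y_2)$. -}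

module Defs where

open import Level using (Level; _⊔_) renaming (suc to lsuc)
open import Data.Product using (Σ; ∃; _×_; _,_)
open import Data.Sum using (_⊎_)
open import Data.Empty renaming (⊥ to Empty)
open import Relation.Nullary using (¬_)
open import Relation.Unary using (Pred; _∈_; _∉_)
open import Relation.Binary using (Rel)
open import Relation.Binary.Lattice.Bundles using (HeytingAlgebra; BooleanAlgebra)
open import Function using (_⇔_)
open import Algebra.Core using (Op₂)
open import Axiom.ExcludedMiddle using (ExcludedMiddle) public

record BasicBiOps {c ℓ₁ ℓ₂} (A : Set c) (_≈_ : Rel A ℓ₁) (_≤_ : Rel A ℓ₂)
                  : Set (c ⊔ ℓ₁ ⊔ ℓ₂) where
  field
    _*_   : Op₂ A
    _-*_  : Op₂ A
    ⊤*    : A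
    _∨*_  : Op₂ A
    _⊖_   : Op₂ A
    ⊥*    : A
    *-comm      : ∀ a b → (a * b) ≈ (b * a)
    *-assoc     : ∀ a b c → ((a * b) * c) ≈ (a * (b * c))
    *-identityʳ : ∀ a → (a * ⊤*) ≈ a
    residuation : ∀ a b c → ((a * b) ≤ c) ⇔ (a ≤ (b -* c))
    ∨*-comm     : ∀ a b → (a ∨* b) ≈ (b ∨* a)
    coresiduation : ∀ a b c → (a ≤ (b ∨* c)) ⇔ ((a ⊖ b) ≤ c)

record BasicBiBIAlgebra c ℓ₁ ℓ₂ : Set (lsuc (c ⊔ ℓ₁ ⊔ ℓ₂)) where
  field
    heyting : HeytingAlgebra c ℓ₁ ℓ₂
  open HeytingAlgebra heyting public
  field
    biOps : BasicBiOps Carrier _≈_ _≤_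
  open BasicBiOps biOps public

record BasicBiBBIAlgebra c ℓ₁ ℓ₂ : Set (lsuc (c ⊔ ℓ₁ ⊔ ℓ₂)) where
  field
    boolean : BooleanAlgebra c ℓ₁ ℓ₂
  open BooleanAlgebra boolean public
  field
    biOps : BasicBiOps Carrier _≈_ _≤_
  open BasicBiOps biOps public

toBiBI : ∀ {c ℓ₁ ℓ₂} → BasicBiBBIAlgebra c ℓ₁ ℓ₂ → BasicBiBIAlgebra c ℓ₁ ℓ₂
toBiBI 𝔸 = record { heyting = BooleanAlgebra.heytingAlgebra (BasicBiBBIAlgebra.boolean 𝔸)
                  ; biOps = BasicBiBBIAlgebra.biOps 𝔸 }

module AlgAxioms {c ℓ₁ ℓ₂} (𝔸 : BasicBiBIAlgebra c ℓ₁ ℓ₂) where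
  open BasicBiBIAlgebra 𝔸

  AxAssoc : Set (c ⊔ ℓ₂)
  AxAssoc = ∀ a b c → (a ∨* (b ∨* c)) ≤ ((a ∨* b) ∨* c)

  Ax⊥*Weak : Set (c ⊔ ℓ₂)
  Ax⊥*Weak = ∀ a → a ≤ (a ∨* ⊥*)

  Ax⊥*Contr : Set (c ⊔ ℓ₂)
  Ax⊥*Contr = ∀ a → (a ∨* ⊥*) ≤ a

  Ax∨*Contr : Set (c ⊔ ℓ₂)
  Ax∨*Contr = ∀ a → (a ∨* a) ≤ a

  AxWeakDist : Set (c ⊔ ℓ₂)
  AxWeakDist = ∀ a b c → (a * (b ∨* c)) ≤ ((a * b) ∨* c)

module _ {c ℓ₁ ℓ₂} (H : HeytingAlgebra c ℓ₁ ℓ₂) where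
  open HeytingAlgebra H

  record IsFilter (F : Pred Carrier (c ⊔ ℓ₁ ⊔ ℓ₂)) : Set (c ⊔ ℓ₁ ⊔ ℓ₂) where
    field
      upClosed : ∀ {a b} → a ∈ F → a ≤ b → b ∈ F
      ⊤∈       : ⊤ ∈ F
      ∧-closed : ∀ {a b} → a ∈ F → b ∈ F → (a ∧ b) ∈ F

  record IsIdeal (I : Pred Carrier (c ⊔ ℓ₁ ⊔ ℓ₂)) : Set (c ⊔ ℓ₁ ⊔ ℓ₂) where
    field
      downClosed : ∀ {a b} → a ∈ I → b ≤ a → b ∈ I
      ⊥∈         : ⊥ ∈ I
      ∨-closed   : ∀ {a b} → a ∈ I → b ∈ I → (a ∨ b) ∈ I

  record IsPrimeFilter (F : Pred Carrier (c ⊔ ℓ₁ ⊔ ℓ₂)) : Set (c ⊔ ℓ₁ ⊔ ℓ₂) where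
    field
      isFilter : IsFilter F
      proper   : ⊥ ∉ F
      prime    : ∀ {a b} → (a ∨ b) ∈ F → a ∈ F ⊎ b ∈ F

  record PrimeFilter : Set (lsuc (c ⊔ ℓ₁ ⊔ ℓ₂)) where
    field
      set           : Pred Carrier (c ⊔ ℓ₁ ⊔ ℓ₂)
      isPrimeFilter : IsPrimeFilter set

  PrimeFilterTheoremFor : Set (lsuc (c ⊔ ℓ₁ ⊔ ℓ₂))
  PrimeFilterTheoremFor =
    ∀ (F I : Pred Carrier (c ⊔ ℓ₁ ⊔ ℓ₂)) → IsFilter F → IsIdeal I →
    (∀ a → a ∈ F → a ∈ I → Empty) →
    Σ PrimeFilter λ G → (∀ a → a ∈ F → a ∈ PrimeFilter.set G)
                      × (∀ a → a ∈ PrimeFilter.set G → a ∈ I → Empty)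

-- The Boolean prime ideal theorem (for distributive lattices, here in the
-- form for Heyting algebras), at the given universe levels.
PrimeFilterTheorem : ∀ c ℓ₁ ℓ₂ → Set (lsuc (c ⊔ ℓ₁ ⊔ ℓ₂))
PrimeFilterTheorem c ℓ₁ ℓ₂ = (H : HeytingAlgebra c ℓ₁ ℓ₂) → PrimeFilterTheoremFor H

module Frames {x r p} (X : Set x) (_≼_ : Rel X r)
              (_∘_ : X → X → Pred X p) (E : Pred X p)
              (_▽_ : X → X → Pred X p) (U : Pred X p) where

  record IsBIFrame : Set (x ⊔ r ⊔ p) where
    field
      ≼-refl      : ∀ x → x ≼ x
      ≼-trans     : ∀ {x y z} → x ≼ y → y ≼ z → x ≼ z
      commutativity : ∀ {x y z} → z ∈ (x ∘ y) → z ∈ (y ∘ x)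
      closure     : ∀ {e e'} → e ∈ E → e ≼ e' → e' ∈ E
      unitExistence : ∀ x → ∃ λ e → e ∈ E × x ∈ (x ∘ e)
      coherence   : ∀ {e x y} → e ∈ E → x ∈ (y ∘ e) → y ≼ x
      associativity : ∀ {t t' x y z w} → t ≼ t' → t ∈ (x ∘ y) → w ∈ (t' ∘ z) →
                      ∃ λ s → ∃ λ s' → ∃ λ w' →
                        (s ≼ s') × s ∈ (y ∘ z) × (w' ≼ w) × w' ∈ (x ∘ s')

  record IsBasicBiFrame : Set (x ⊔ r ⊔ p) where
    field
      isBIFrame : IsBIFrame
      ▽-comm    : ∀ {x y z} → z ∈ (x ▽ y) → z ∈ (y ▽ x)
      U-down    : ∀ {u u'} → u ∈ U → u' ≼ u → u' ∈ U

  FrAssoc : Set (x ⊔ r ⊔ p)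
  FrAssoc = ∀ {t t' x y z w} → t' ≼ t → t ∈ (x ▽ y) → w ∈ (t' ▽ z) →
            ∃ λ s → ∃ λ s' → ∃ λ w' →
              (s' ≼ s) × s ∈ (y ▽ z) × (w ≼ w') × w' ∈ (x ▽ s')

  Fr⊥*Weak : Set (x ⊔ r ⊔ p)
  Fr⊥*Weak = ∀ {u x y} → u ∈ U → x ∈ (y ▽ u) → x ≼ y

  Fr⊥*Contr : Set (x ⊔ p)
  Fr⊥*Contr = ∀ w → ∃ λ u → u ∈ U × w ∈ (w ▽ u)

  Fr∨*Contr : Set (x ⊔ p)
  Fr∨*Contr = ∀ x → x ∈ (x ▽ x)

  FrWeakDist : Set (x ⊔ r ⊔ p)
  FrWeakDist = ∀ {t t' t'' x₁ x₂ y₁ y₂} →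
               t ≼ t' → t ∈ (x₁ ∘ x₂) → t' ≼ t'' → t'' ∈ (y₁ ▽ y₂) →
               ∃ λ w → y₁ ∈ (x₁ ∘ w) × x₂ ∈ (w ▽ y₂)

module PrimeFilterFrame {c ℓ₁ ℓ₂} (𝔸 : BasicBiBIAlgebra c ℓ₁ ℓ₂) where
  open BasicBiBIAlgebra 𝔸

  Pr : Set (lsuc (c ⊔ ℓ₁ ⊔ ℓ₂))
  Pr = PrimeFilter heyting

  ∣_∣ : Pr → Pred Carrier (c ⊔ ℓ₁ ⊔ ℓ₂)
  ∣ F ∣ = PrimeFilter.set F

  _⊆ₚ_ : Rel Pr (c ⊔ ℓ₁ ⊔ ℓ₂)
  F ⊆ₚ G = ∀ a → a ∈ ∣ F ∣ → a ∈ ∣ G ∣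

  _≐ₚ_ : Rel Pr (c ⊔ ℓ₁ ⊔ ℓ₂)
  F ≐ₚ G = (F ⊆ₚ G) × (G ⊆ₚ F)

  _∘𝔸_ : Pr → Pr → Pred Pr (c ⊔ ℓ₁ ⊔ ℓ₂)
  (F ∘𝔸 F') F'' = ∀ a b → a ∈ ∣ F ∣ → b ∈ ∣ F' ∣ → (a * b) ∈ ∣ F'' ∣

  E𝔸 : Pred Pr (c ⊔ ℓ₁ ⊔ ℓ₂)
  E𝔸 F = ⊤* ∈ ∣ F ∣

  _▽𝔸_ : Pr → Pr → Pred Pr (c ⊔ ℓ₁ ⊔ ℓ₂)
  (F ▽𝔸 F') F'' = ∀ a b → (a ∨* b) ∈ ∣ F'' ∣ → a ∈ ∣ F ∣ ⊎ b ∈ ∣ F' ∣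

  U𝔸 : Pred Pr (c ⊔ ℓ₁ ⊔ ℓ₂)
  U𝔸 F = ⊥* ∉ ∣ F ∣

  module PrFrame = Frames Pr _⊆ₚ_ _∘𝔸_ E𝔸 _▽𝔸_ U𝔸
  module PrFrame= = Frames Pr _≐ₚ_ _∘𝔸_ E𝔸 _▽𝔸_ U𝔸

-- The content of Lemma 6.21 for a given algebra, relative to a choice of
-- the frame relation (⊆ for BiBI, = for BiBBI).

module _ {c ℓ₁ ℓ₂} (𝔸 : BasicBiBIAlgebra c ℓ₁ ℓ₂) where
  open AlgAxioms 𝔸
  open PrimeFilterFrame 𝔸

  PrFrameFacts : Rel Pr (c ⊔ ℓ₁ ⊔ ℓ₂) → Set (lsuc (c ⊔ ℓ₁ ⊔ ℓ₂))
  PrFrameFacts _≼_ =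
    IsBasicBiFrame
    × (AxAssoc    → FrAssoc)
    × (Ax⊥*Weak   → Fr⊥*Weak)
    × (Ax⊥*Contr  → Fr⊥*Contr)
    × (Ax∨*Contr  → Fr∨*Contr)
    × (AxWeakDist → FrWeakDist)
    where open Frames Pr _≼_ _∘𝔸_ E𝔸 _▽𝔸_ U𝔸

-- Each existential frame condition asks for a prime filter G.  It is obtained from the
-- prime filter theorem by separating a filter that G must contain from an ideal that G
-- must avoid; the monoid laws, resp. the algebraic axiom in question, make the two
-- disjoint.  Membership in ∘ and ▽ is then read off the separation by case analysis on
-- membership in prime filters, which is where excluded middle enters.  In the Boolean
-- case prime filters are maximal, so inclusion of prime filters already is equality
-- and the BiBBI frame facts are the BiBI ones.
module Submission where

open import Level using (Level; Lift; lift; lower) renaming (suc to lsuc; _⊔_ to _⊔ℓ_)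
open import Data.Product using (_×_; _,_; ∃; proj₁)
open import Data.Sum using (inj₁; inj₂; [_,_]′)
open import Data.Empty using (⊥-elim)
open import Relation.Nullary using (Dec; yes; no)
open import Relation.Nullary.Decidable using (map′)
open import Relation.Unary using (Pred; _∈_; _∉_)
open import Relation.Binary using (Rel)
open import Function using (id; _∘′_)
open import Function.Bundles using (Equivalence)
open import Relation.Binary.Lattice.Bundles using (HeytingAlgebra; BooleanAlgebra)
open import Defs

module BasicBiAlgebraProperties {c ℓ₁ ℓ₂} (𝔸 : BasicBiBIAlgebra c ℓ₁ ℓ₂) where
  open BasicBiBIAlgebra 𝔸

  *-monoˡ-≤ : ∀ {a a' b} → a ≤ a' → (a * b) ≤ (a' * b)
  *-monoˡ-≤ {b = b} a≤a' =
    Equivalence.from (residuation _ b _) (trans a≤a' (Equivalence.to (residuation _ b _) refl))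

  *-monoʳ-≤ : ∀ {a b b'} → b ≤ b' → (a * b) ≤ (a * b')
  *-monoʳ-≤ {a} {b} {b'} b≤b' =
    trans (reflexive (*-comm a b)) (trans (*-monoˡ-≤ b≤b') (reflexive (*-comm b' a)))

  *-mono-≤ : ∀ {a a' b b'} → a ≤ a' → b ≤ b' → (a * b) ≤ (a' * b')
  *-mono-≤ a≤a' b≤b' = trans (*-monoˡ-≤ a≤a') (*-monoʳ-≤ b≤b')

  *-zeroʳ-≤ : ∀ a → (a * ⊥) ≤ ⊥
  *-zeroʳ-≤ a = trans (reflexive (*-comm a ⊥)) (Equivalence.from (residuation ⊥ a ⊥) (minimum _))

  *-distribˡ-∨-≤ : ∀ a b b' → (a * (b ∨ b')) ≤ ((a * b) ∨ (a * b'))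
  *-distribˡ-∨-≤ a b b' = trans (reflexive (*-comm a (b ∨ b')))
    (Equivalence.from (residuation _ a _)
      (∨-least (Equivalence.to (residuation b a _) (trans (reflexive (*-comm b a)) (x≤x∨y _ _)))
               (Equivalence.to (residuation b' a _) (trans (reflexive (*-comm b' a)) (y≤x∨y _ _)))))

  ∨*-monoʳ-≤ : ∀ {a b b'} → b ≤ b' → (a ∨* b) ≤ (a ∨* b')
  ∨*-monoʳ-≤ {a} b≤b' =
    Equivalence.from (coresiduation _ a _) (trans (Equivalence.to (coresiduation _ a _) refl) b≤b')

  ∨*-monoˡ-≤ : ∀ {a a' b} → a ≤ a' → (a ∨* b) ≤ (a' ∨* b)
  ∨*-monoˡ-≤ {a} {a'} {b} a≤a' =
    trans (reflexive (∨*-comm a b)) (trans (∨*-monoʳ-≤ a≤a') (reflexive (∨*-comm b a')))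

  ∨*-mono-≤ : ∀ {a a' b b'} → a ≤ a' → b ≤ b' → (a ∨* b) ≤ (a' ∨* b')
  ∨*-mono-≤ a≤a' b≤b' = trans (∨*-monoˡ-≤ a≤a') (∨*-monoʳ-≤ b≤b')

  ∨*-maximumʳ : ∀ a → ⊤ ≤ (a ∨* ⊤)
  ∨*-maximumʳ a = Equivalence.from (coresiduation ⊤ a ⊤) (maximum _)

  ∨*-distribˡ-∧-≥ : ∀ a b b' → ((a ∨* b) ∧ (a ∨* b')) ≤ (a ∨* (b ∧ b'))
  ∨*-distribˡ-∧-≥ a b b' = Equivalence.from (coresiduation _ a _)
    (∧-greatest (Equivalence.to (coresiduation _ a _) (x∧y≤x _ _))
                (Equivalence.to (coresiduation _ a _) (x∧y≤y _ _)))

module PrimeFilterProperties {c ℓ₁ ℓ₂} {H : HeytingAlgebra c ℓ₁ ℓ₂} (F : PrimeFilter H) where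
  open IsPrimeFilter (PrimeFilter.isPrimeFilter F) public
  open IsFilter isFilter public

private module PF = PrimeFilterProperties

module _ {c ℓ₁ ℓ₂} (B : BooleanAlgebra c ℓ₁ ℓ₂) where
  open BooleanAlgebra B
  open PrimeFilter

  primeFilter-maximal : (F G : PrimeFilter heytingAlgebra) →
                        (∀ a → a ∈ set F → a ∈ set G) → ∀ a → a ∈ set G → a ∈ set F
  primeFilter-maximal F G F⊆G a a∈G
    with PF.prime F (PF.upClosed F (PF.⊤∈ F) (transpose-⇨ (x∧y≤y ⊤ a)))
  ... | inj₂ a∈F  = a∈F
  ... | inj₁ ¬a∈F = ⊥-elim (PF.proper G (PF.upClosed G (PF.∧-closed G (F⊆G _ ¬a∈F) a∈G)
                                                        (transpose-∧ (x≤x∨y (¬ a) ⊥))))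

module FrameTransport {x r r' p} {X : Set x} {_≼_ : Rel X r} {_≼'_ : Rel X r'}
         {_∘_ : X → X → Pred X p} {E : Pred X p} {_▽_ : X → X → Pred X p} {U : Pred X p}
         (≼⇒≼' : ∀ {x y} → x ≼ y → x ≼' y) (≼'⇒≼ : ∀ {x y} → x ≼' y → x ≼ y) where
  private
    module S = Frames X _≼_ _∘_ E _▽_ U
    module T = Frames X _≼'_ _∘_ E _▽_ U

  isBIFrame : S.IsBIFrame → T.IsBIFrame
  isBIFrame bi = record
    { ≼-refl        = λ x → ≼⇒≼' (≼-refl x)
    ; ≼-trans       = λ x≼y y≼z → ≼⇒≼' (≼-trans (≼'⇒≼ x≼y) (≼'⇒≼ y≼z))
    ; commutativity = commutativity
    ; closure       = λ e∈E e≼e' → closure e∈E (≼'⇒≼ e≼e')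
    ; unitExistence = unitExistence
    ; coherence     = λ e∈E x∈y∘e → ≼⇒≼' (coherence e∈E x∈y∘e)
    ; associativity = λ t≼t' t∈x∘y w∈t'∘z → transport (associativity (≼'⇒≼ t≼t') t∈x∘y w∈t'∘z)
    }
    where
    open S.IsBIFrame bi
    transport : ∀ {x y z w} →
      (∃ λ s → ∃ λ s' → ∃ λ w' → (s ≼ s') × s ∈ (y ∘ z) × (w' ≼ w) × w' ∈ (x ∘ s')) →
      (∃ λ s → ∃ λ s' → ∃ λ w' → (s ≼' s') × s ∈ (y ∘ z) × (w' ≼' w) × w' ∈ (x ∘ s'))
    transport (s , s' , w' , s≼s' , s∈ , w'≼w , w'∈) = s , s' , w' , ≼⇒≼' s≼s' , s∈ , ≼⇒≼' w'≼w , w'∈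

  isBasicBiFrame : S.IsBasicBiFrame → T.IsBasicBiFrame
  isBasicBiFrame bf = record
    { isBIFrame = isBIFrame (S.IsBasicBiFrame.isBIFrame bf)
    ; ▽-comm    = S.IsBasicBiFrame.▽-comm bf
    ; U-down    = λ u∈U u'≼u → S.IsBasicBiFrame.U-down bf u∈U (≼'⇒≼ u'≼u)
    }

  frAssoc : S.FrAssoc → T.FrAssoc
  frAssoc assoc t'≼t t∈x▽y w∈t'▽z with assoc (≼'⇒≼ t'≼t) t∈x▽y w∈t'▽z
  ... | s , s' , w' , s'≼s , s∈ , w≼w' , w'∈ = s , s' , w' , ≼⇒≼' s'≼s , s∈ , ≼⇒≼' w≼w' , w'∈

  fr⊥*Weak : S.Fr⊥*Weak → T.Fr⊥*Weak
  fr⊥*Weak weak u∈U x∈y▽u = ≼⇒≼' (weak u∈U x∈y▽u)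

  frWeakDist : S.FrWeakDist → T.FrWeakDist
  frWeakDist wd t≼t' t∈ t'≼t'' t''∈ = wd (≼'⇒≼ t≼t') t∈ (≼'⇒≼ t'≼t'') t''∈

module _ {c ℓ₁ ℓ₂} {𝔸 : BasicBiBIAlgebra c ℓ₁ ℓ₂} where
  open PrimeFilterFrame 𝔸

  prFrameFacts-transport : {R R' : Rel Pr (c ⊔ℓ ℓ₁ ⊔ℓ ℓ₂)} →
                           (∀ {F G} → R F G → R' F G) → (∀ {F G} → R' F G → R F G) →
                           PrFrameFacts 𝔸 R → PrFrameFacts 𝔸 R'
  prFrameFacts-transport R⇒R' R'⇒R (bf , assoc , weak , contr , ∨contr , wd) =
    isBasicBiFrame bf , frAssoc ∘′ assoc , fr⊥*Weak ∘′ weak , contr , ∨contr , frWeakDist ∘′ wd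
    where open FrameTransport {_∘_ = _∘𝔸_} {E𝔸} {_▽𝔸_} {U𝔸} R⇒R' R'⇒R

-- The filters and ideals fed to the prime filter theorem.  For prime filters x, w, G:
-- w ∈ x ∘ G iff G misses ∘-ideal x w, and w ∈ x ▽ G iff G contains ▽-filter x w.
module SeparatingSets {c ℓ₁ ℓ₂} (𝔸 : BasicBiBIAlgebra c ℓ₁ ℓ₂) where
  open BasicBiBIAlgebra 𝔸
  open PrimeFilterFrame 𝔸
  open BasicBiAlgebraProperties 𝔸

  private
    L : Level
    L = c ⊔ℓ ℓ₁ ⊔ℓ ℓ₂

  ⊤*-filter : Pred Carrier L
  ⊤*-filter b = Lift L (⊤* ≤ b)

  ⊥*-ideal : Pred Carrier L
  ⊥*-ideal d = Lift L (d ≤ ⊥*)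

  *-filter : Pr → Pr → Pred Carrier L
  *-filter y z e = ∃ λ b → ∃ λ c → b ∈ ∣ y ∣ × c ∈ ∣ z ∣ × (b * c) ≤ e

  ∨*-ideal : Pr → Pr → Pred Carrier L
  ∨*-ideal y z d = ∃ λ b → ∃ λ c → b ∉ ∣ y ∣ × c ∉ ∣ z ∣ × d ≤ (b ∨* c)

  ∘-ideal : Pr → Pr → Pred Carrier L
  ∘-ideal x w d = ∃ λ a → a ∈ ∣ x ∣ × (a * d) ∉ ∣ w ∣

  ▽-filter : Pr → Pr → Pred Carrier L
  ▽-filter x w d = ∃ λ a → a ∉ ∣ x ∣ × (a ∨* d) ∈ ∣ w ∣

  ⊤*-isFilter : IsFilter heyting ⊤*-filter
  ⊤*-isFilter = record
    { upClosed = λ { (lift ⊤*≤a) a≤b → lift (trans ⊤*≤a a≤b) }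
    ; ⊤∈       = lift (maximum ⊤*)
    ; ∧-closed = λ { (lift ⊤*≤a) (lift ⊤*≤b) → lift (∧-greatest ⊤*≤a ⊤*≤b) }
    }

  ⊥*-isIdeal : IsIdeal heyting ⊥*-ideal
  ⊥*-isIdeal = record
    { downClosed = λ { (lift a≤⊥*) b≤a → lift (trans b≤a a≤⊥*) }
    ; ⊥∈         = lift (minimum ⊥*)
    ; ∨-closed   = λ { (lift a≤⊥*) (lift b≤⊥*) → lift (∨-least a≤⊥* b≤⊥*) }
    }

  *-isFilter : ∀ y z → IsFilter heyting (*-filter y z)
  *-isFilter y z = record
    { upClosed = λ { (b , c , b∈y , c∈z , b*c≤e) e≤e' → b , c , b∈y , c∈z , trans b*c≤e e≤e' }
    ; ⊤∈       = ⊤ , ⊤ , PF.⊤∈ y , PF.⊤∈ z , maximum _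
    ; ∧-closed = λ { (b₁ , c₁ , b₁∈y , c₁∈z , le₁) (b₂ , c₂ , b₂∈y , c₂∈z , le₂) →
        (b₁ ∧ b₂) , (c₁ ∧ c₂) , PF.∧-closed y b₁∈y b₂∈y , PF.∧-closed z c₁∈z c₂∈z ,
        ∧-greatest (trans (*-mono-≤ (x∧y≤x _ _) (x∧y≤x _ _)) le₁)
                   (trans (*-mono-≤ (x∧y≤y _ _) (x∧y≤y _ _)) le₂) }
    }

  ∨*-isIdeal : ∀ y z → IsIdeal heyting (∨*-ideal y z)
  ∨*-isIdeal y z = record
    { downClosed = λ { (b , c , b∉y , c∉z , d≤b∨*c) d'≤d → b , c , b∉y , c∉z , trans d'≤d d≤b∨*c }
    ; ⊥∈         = ⊥ , ⊥ , PF.proper y , PF.proper z , minimum _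
    ; ∨-closed   = λ { (b₁ , c₁ , b₁∉y , c₁∉z , le₁) (b₂ , c₂ , b₂∉y , c₂∉z , le₂) →
        (b₁ ∨ b₂) , (c₁ ∨ c₂) , [ b₁∉y , b₂∉y ]′ ∘′ PF.prime y , [ c₁∉z , c₂∉z ]′ ∘′ PF.prime z ,
        ∨-least (trans le₁ (∨*-mono-≤ (x≤x∨y _ _) (x≤x∨y _ _)))
                (trans le₂ (∨*-mono-≤ (y≤x∨y _ _) (y≤x∨y _ _))) }
    }

  ∘-isIdeal : ∀ x w → IsIdeal heyting (∘-ideal x w)
  ∘-isIdeal x w = record
    { downClosed = λ { (a , a∈x , a*d∉w) d'≤d →
        a , a∈x , λ a*d'∈w → a*d∉w (PF.upClosed w a*d'∈w (*-monoʳ-≤ d'≤d)) }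
    ; ⊥∈         = ⊤ , PF.⊤∈ x , λ ⊤*⊥∈w → PF.proper w (PF.upClosed w ⊤*⊥∈w (*-zeroʳ-≤ ⊤))
    ; ∨-closed   = λ { {d₁} {d₂} (a₁ , a₁∈x , a₁*d₁∉w) (a₂ , a₂∈x , a₂*d₂∉w) →
        (a₁ ∧ a₂) , PF.∧-closed x a₁∈x a₂∈x , λ a*d∈w →
          [ (λ h → a₁*d₁∉w (PF.upClosed w h (*-monoˡ-≤ (x∧y≤x a₁ a₂))))
          , (λ h → a₂*d₂∉w (PF.upClosed w h (*-monoˡ-≤ (x∧y≤y a₁ a₂)))) ]′
          (PF.prime w (PF.upClosed w a*d∈w (*-distribˡ-∨-≤ _ d₁ d₂))) }
    }

  ▽-isFilter : ∀ x w → IsFilter heyting (▽-filter x w)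
  ▽-isFilter x w = record
    { upClosed = λ { (a , a∉x , a∨*d∈w) d≤d' → a , a∉x , PF.upClosed w a∨*d∈w (∨*-monoʳ-≤ d≤d') }
    ; ⊤∈       = ⊥ , PF.proper x , PF.upClosed w (PF.⊤∈ w) (∨*-maximumʳ ⊥)
    ; ∧-closed = λ { {d₁} {d₂} (a₁ , a₁∉x , a₁∨*d₁∈w) (a₂ , a₂∉x , a₂∨*d₂∈w) →
        (a₁ ∨ a₂) , [ a₁∉x , a₂∉x ]′ ∘′ PF.prime x ,
        PF.upClosed w (PF.∧-closed w (PF.upClosed w a₁∨*d₁∈w (∨*-monoˡ-≤ (x≤x∨y a₁ a₂)))
                                     (PF.upClosed w a₂∨*d₂∈w (∨*-monoˡ-≤ (y≤x∨y a₁ a₂))))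
                      (∨*-distribˡ-∧-≥ _ d₁ d₂) }
    }

module PrimeFilterFrameProperties {c ℓ₁ ℓ₂}
         (em : ExcludedMiddle (lsuc (c ⊔ℓ ℓ₁ ⊔ℓ ℓ₂))) (pft : PrimeFilterTheorem c ℓ₁ ℓ₂)
         (𝔸 : BasicBiBIAlgebra c ℓ₁ ℓ₂) where
  open BasicBiBIAlgebra 𝔸
  open PrimeFilterFrame 𝔸
  open AlgAxioms 𝔸
  open BasicBiAlgebraProperties 𝔸
  open SeparatingSets 𝔸
  open Frames Pr _⊆ₚ_ _∘𝔸_ E𝔸 _▽𝔸_ U𝔸

  private
    decide : (P : Set (c ⊔ℓ ℓ₁ ⊔ℓ ℓ₂)) → Dec P
    decide P = map′ lower lift em

  disjoint⇒∈∘ : ∀ x w G → (∀ d → d ∈ ∣ G ∣ → d ∉ ∘-ideal x w) → w ∈ (x ∘𝔸 G)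
  disjoint⇒∈∘ x w G G-misses a d a∈x d∈G with decide ((a * d) ∈ ∣ w ∣)
  ... | yes a*d∈w = a*d∈w
  ... | no  a*d∉w = ⊥-elim (G-misses d d∈G (a , a∈x , a*d∉w))

  ⊇⇒∈▽ : ∀ x w G → (∀ d → d ∈ ▽-filter x w → d ∈ ∣ G ∣) → w ∈ (x ▽𝔸 G)
  ⊇⇒∈▽ x w G ▽-filter⊆G a d a∨*d∈w with decide (a ∈ ∣ x ∣)
  ... | yes a∈x = inj₁ a∈x
  ... | no  a∉x = inj₂ (▽-filter⊆G d (a , a∉x , a∨*d∈w))

  disjoint⇒∈▽ : ∀ y z G → (∀ d → d ∈ ∣ G ∣ → d ∉ ∨*-ideal y z) → G ∈ (y ▽𝔸 z)
  disjoint⇒∈▽ y z G G-misses b c b∨*c∈G with decide (b ∈ ∣ y ∣) | decide (c ∈ ∣ z ∣)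
  ... | yes b∈y | _       = inj₁ b∈y
  ... | no  _   | yes c∈z = inj₂ c∈z
  ... | no  b∉y | no  c∉z = ⊥-elim (G-misses _ b∨*c∈G (b , c , b∉y , c∉z , refl))

  ⊆ₚ-refl : ∀ x → x ⊆ₚ x
  ⊆ₚ-refl x a a∈x = a∈x

  ▽𝔸-comm : ∀ x y z → z ∈ (x ▽𝔸 y) → z ∈ (y ▽𝔸 x)
  ▽𝔸-comm _ _ z z∈x▽y a b a∨*b∈z =
    [ inj₂ , inj₁ ]′ (z∈x▽y b a (PF.upClosed z a∨*b∈z (reflexive (∨*-comm a b))))

  unitExistence : ∀ x → ∃ λ e → e ∈ E𝔸 × x ∈ (x ∘𝔸 e)
  unitExistence x =
    let G , ⊤*-filter⊆G , G-misses = pft heyting _ _ ⊤*-isFilter (∘-isIdeal x x) disjoint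
    in G , ⊤*-filter⊆G ⊤* (lift refl) , disjoint⇒∈∘ x x G G-misses
    where
    disjoint : ∀ b → b ∈ ⊤*-filter → b ∉ ∘-ideal x x
    disjoint b (lift ⊤*≤b) (a , a∈x , a*b∉x) =
      a*b∉x (PF.upClosed x a∈x (trans (reflexive (Eq.sym (*-identityʳ a))) (*-monoʳ-≤ ⊤*≤b)))

  associativity : ∀ {t t' x y z w} → t ⊆ₚ t' → t ∈ (x ∘𝔸 y) → w ∈ (t' ∘𝔸 z) →
                  ∃ λ s → ∃ λ s' → ∃ λ w' →
                    (s ⊆ₚ s') × s ∈ (y ∘𝔸 z) × (w' ⊆ₚ w) × w' ∈ (x ∘𝔸 s')
  associativity {t} {t'} {x} {y} {z} {w} t⊆t' t∈x∘y w∈t'∘z =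
    let G , *-filter⊆G , G-misses = pft heyting _ _ (*-isFilter y z) (∘-isIdeal x w) disjoint
    in G , G , w , ⊆ₚ-refl G , (λ b c b∈y c∈z → *-filter⊆G _ (b , c , b∈y , c∈z , refl)) ,
       ⊆ₚ-refl w , disjoint⇒∈∘ x w G G-misses
    where
    disjoint : ∀ e → e ∈ *-filter y z → e ∉ ∘-ideal x w
    disjoint e (b , c , b∈y , c∈z , b*c≤e) (a , a∈x , a*e∉w) =
      a*e∉w (PF.upClosed w (w∈t'∘z (a * b) c (t⊆t' _ (t∈x∘y a b a∈x b∈y)) c∈z)
                           (trans (reflexive (*-assoc a b c)) (*-monoʳ-≤ b*c≤e)))

  isBasicBiFrame : IsBasicBiFrame
  isBasicBiFrame = record
    { isBIFrame = record
      { ≼-refl        = ⊆ₚ-refl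
      ; ≼-trans       = λ x⊆y y⊆z a a∈x → y⊆z a (x⊆y a a∈x)
      ; commutativity = λ {_} {_} {z} z∈x∘y a b a∈y b∈x →
                          PF.upClosed z (z∈x∘y b a b∈x a∈y) (reflexive (*-comm b a))
      ; closure       = λ e∈E e⊆e' → e⊆e' ⊤* e∈E
      ; unitExistence = unitExistence
      ; coherence     = λ {_} {x} e∈E x∈y∘e a a∈y →
                          PF.upClosed x (x∈y∘e a ⊤* a∈y e∈E) (reflexive (*-identityʳ a))
      ; associativity = λ {t t' x y z w} → associativity {t} {t'} {x} {y} {z} {w}
      }
    ; ▽-comm = λ {x y z} → ▽𝔸-comm x y z
    ; U-down = λ u∈U u'⊆u ⊥*∈u' → u∈U (u'⊆u ⊥* ⊥*∈u')
    }

  axAssoc⇒frAssoc : AxAssoc → FrAssoc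
  axAssoc⇒frAssoc assoc {t} {t'} {x} {y} {z} {w} t'⊆t t∈x▽y w∈t'▽z =
    let G , ▽-filter⊆G , G-misses = pft heyting _ _ (▽-isFilter x w) (∨*-isIdeal y z) disjoint
    in G , G , w , ⊆ₚ-refl G , disjoint⇒∈▽ y z G G-misses , ⊆ₚ-refl w , ⊇⇒∈▽ x w G ▽-filter⊆G
    where
    disjoint : ∀ d → d ∈ ▽-filter x w → d ∉ ∨*-ideal y z
    disjoint d (a , a∉x , a∨*d∈w) (b , c , b∉y , c∉z , d≤b∨*c) =
      [ [ a∉x , b∉y ]′ ∘′ t∈x▽y a b ∘′ t'⊆t _ , c∉z ]′
        (w∈t'▽z (a ∨* b) c (PF.upClosed w (PF.upClosed w a∨*d∈w (∨*-monoʳ-≤ d≤b∨*c)) (assoc a b c)))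

  ax⊥*Weak⇒fr⊥*Weak : Ax⊥*Weak → Fr⊥*Weak
  ax⊥*Weak⇒fr⊥*Weak weak {x = x} u∈U x∈y▽u a a∈x =
    [ id , ⊥-elim ∘′ u∈U ]′ (x∈y▽u a ⊥* (PF.upClosed x a∈x (weak a)))

  ax⊥*Contr⇒fr⊥*Contr : Ax⊥*Contr → Fr⊥*Contr
  ax⊥*Contr⇒fr⊥*Contr contr w =
    let G , ▽-filter⊆G , G-misses = pft heyting _ _ (▽-isFilter w w) ⊥*-isIdeal disjoint
    in G , (λ ⊥*∈G → G-misses ⊥* ⊥*∈G (lift refl)) , ⊇⇒∈▽ w w G ▽-filter⊆G
    where
    disjoint : ∀ d → d ∈ ▽-filter w w → d ∉ ⊥*-ideal
    disjoint d (a , a∉w , a∨*d∈w) (lift d≤⊥*) =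
      a∉w (PF.upClosed w (PF.upClosed w a∨*d∈w (∨*-monoʳ-≤ d≤⊥*)) (contr a))

  ax∨*Contr⇒fr∨*Contr : Ax∨*Contr → Fr∨*Contr
  ax∨*Contr⇒fr∨*Contr contr x a b a∨*b∈x =
    PF.prime x (PF.upClosed x a∨*b∈x (trans (∨*-mono-≤ (x≤x∨y a b) (y≤x∨y a b)) (contr (a ∨ b))))

  axWeakDist⇒frWeakDist : AxWeakDist → FrWeakDist
  axWeakDist⇒frWeakDist wd {t} {t'} {t''} {x₁} {x₂} {y₁} {y₂} t⊆t' t∈x₁∘x₂ t'⊆t'' t''∈y₁▽y₂ =
    let G , ▽-filter⊆G , G-misses = pft heyting _ _ (▽-isFilter y₂ x₂) (∘-isIdeal x₁ y₁) disjoint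
    in G , disjoint⇒∈∘ x₁ y₁ G G-misses , ▽𝔸-comm y₂ G x₂ (⊇⇒∈▽ y₂ x₂ G ▽-filter⊆G)
    where
    disjoint : ∀ c → c ∈ ▽-filter y₂ x₂ → c ∉ ∘-ideal x₁ y₁
    disjoint c (d , d∉y₂ , d∨*c∈x₂) (a , a∈x₁ , a*c∉y₁) =
      [ a*c∉y₁ , d∉y₂ ]′ (t''∈y₁▽y₂ (a * c) d (PF.upClosed t'' a*[c∨*d]∈t'' (wd a c d)))
      where
      a*[c∨*d]∈t'' : (a * (c ∨* d)) ∈ ∣ t'' ∣
      a*[c∨*d]∈t'' = t'⊆t'' _ (t⊆t' _
        (t∈x₁∘x₂ a (c ∨* d) a∈x₁ (PF.upClosed x₂ d∨*c∈x₂ (reflexive (∨*-comm d c)))))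

  prFrameFacts : PrFrameFacts 𝔸 _⊆ₚ_
  prFrameFacts = isBasicBiFrame , axAssoc⇒frAssoc , ax⊥*Weak⇒fr⊥*Weak , ax⊥*Contr⇒fr⊥*Contr ,
                 ax∨*Contr⇒fr∨*Contr , axWeakDist⇒frWeakDist

lemma6p21 : ∀ {c ℓ₁ ℓ₂ : Level} →
    ExcludedMiddle (Level.suc (c Level.⊔ ℓ₁ Level.⊔ ℓ₂)) →
    PrimeFilterTheorem c ℓ₁ ℓ₂ →
    ((𝔸 : BasicBiBIAlgebra c ℓ₁ ℓ₂) →
       PrFrameFacts 𝔸 (PrimeFilterFrame._⊆ₚ_ 𝔸))
    ×
    ((𝔹 : BasicBiBBIAlgebra c ℓ₁ ℓ₂) →
       (∀ F G → PrimeFilterFrame._⊆ₚ_ (toBiBI 𝔹) F G → PrimeFilterFrame._⊆ₚ_ (toBiBI 𝔹) G F)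
       × PrFrameFacts (toBiBI 𝔹) (PrimeFilterFrame._≐ₚ_ (toBiBI 𝔹)))
lemma6p21 em pft = prFrameFacts , λ 𝔹 →
  let maximal = primeFilter-maximal (BasicBiBBIAlgebra.boolean 𝔹)
  in maximal , prFrameFacts-transport {𝔸 = toBiBI 𝔹} (λ {F G} F⊆G → F⊆G , maximal F G F⊆G) proj₁
                                      (prFrameFacts (toBiBI 𝔹))
  where open PrimeFilterFrameProperties em pft using (prFrameFacts)
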